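{- Let $k\geq 2$ be an integer. Then for every integer $m\geq k-1$, $C_{2^m-1}\equiv C_{2^{k-1}-1}\pmod {2^k}$.
   Context: $C_n := \frac{(2n)!}{(n+1)!\,n!}$ denotes the $n$-th Catalan number. -}

module Defs where

open import Data.Nat using (ℕ; _*_; _+_; _/_; _!)
open import Data.Nat.Properties using (m*n≢0; _!≢0)

catalan : ℕ → ℕ
catalan n = ((2 * n) !) / (((n + 1) !) * (n !)) where
  instance
    nz : _
    nz = m*n≢0 ((n + 1) !) (n !) {{(n + 1) !≢0}} {{n !≢0}}

open import Data.Integer using (ℤ; +_; _-_)
open import Data.Integer.Divisibility using (_∣_)

_≡_[mod_] : ℕ → ℕ → ℕ → Set
a ≡ b [mod n ] = (+ n) ∣ ((+ a) - (+ b))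

-- With (2n − 1)!! the product of the first n odd numbers, (2n)! = 2ⁿ n! (2n − 1)!!, hence
-- C(n) (n + 1)! = 2ⁿ (2n − 1)!!, and comparing C(2n + 1) with C(n) gives
--   C(2n + 1) · (2n + 1)!! · (2n − 1)!! = C(n) · (4n + 1)!!.
-- The odd factors of (4n + 3)!! above 2n + 1 are those below it shifted by 2(n + 1), so
-- (4n + 3)!! ≡ ((2n + 1)!!)² mod 2(n + 1), and the identity becomes
--   C(2n + 1) · ((2n + 1)!!)² ≡ C(n) · ((2n + 1)!!)²  mod 2(n + 1).
-- When n + 1 = 2^m the odd square cancels: C(2^(m+1) − 1) ≡ C(2^m − 1) mod 2^(m+1), and these
-- congruences chain from m = k − 1 upwards.
module Submission where

open import Defs
open import Data.Nat using (ℕ; zero; suc; _+_; _*_; _≤_; _∸_; _^_; _!; pred; z≤n; s≤s)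
open import Data.Nat.Properties
  using (+-comm; +-identityʳ; +-suc; *-assoc; *-comm; *-identityʳ; *-suc; *-cancelˡ-≡; *-cancelʳ-≡;
         m+n∸m≡n; m∸n+n≡m; m≤m+n; m≤n+m; n≤1+n; m≤n+m∸n; ≤-trans; m^n≢0; ^-distribˡ-+-*; suc-pred;
         _!≢0; _!*_!≢0)
open import Data.Nat.Divisibility
  using (_∣_; divides; ∣-refl; ∣-trans; _∣0; 1∣_; n∣m*n; m∣m*n; ∣m⇒∣m*n; ∣m+n∣m⇒∣n;
         *-monoʳ-∣; *-cancelˡ-∣)
open import Data.Nat.DivMod using (m/n*n≡m)
open import Data.Nat.Combinatorics using (k![n∸k]!∣n!)
open import Data.Nat.Tactic.RingSolver using (solve-∀)
open import Data.Integer using (+_; ∣_∣) renaming (_+_ to _+ℤ_; _*_ to _*ℤ_; _-_ to _-ℤ_)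
open import Data.Integer.Properties using (pos-*; pos-+; abs-*; +-inverseʳ; ∣i-j∣≡∣j-i∣)
import Data.Integer.Divisibility.Signed as Signed
import Data.Integer.Tactic.RingSolver as ℤ-Solver
open import Data.Product using (∃-syntax; _,_)
open import Level using (0ℓ)
open import Relation.Binary.Bundles using (Setoid)
open import Relation.Binary.PropositionalEquality
  using (_≡_; refl; sym; trans; cong; cong₂; subst; subst₂; module ≡-Reasoning)

-- Since _≡_[mod_] unfolds to divisibility of ∣ + a - + b ∣, its arguments cannot be inferred and are often
-- passed explicitly; and since it has default fixity, products inside it need parentheses.
≡-mod-refl : ∀ {n a} → a ≡ a [mod n ]
≡-mod-refl {n} {a} = subst (λ d → n ∣ ∣ d ∣) (sym (+-inverseʳ (+ a))) (n ∣0)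

≡-mod-sym : ∀ {n a b} → a ≡ b [mod n ] → b ≡ a [mod n ]
≡-mod-sym {n} {a} {b} = subst (n ∣_) (∣i-j∣≡∣j-i∣ (+ a) (+ b))

≡-mod-trans : ∀ {n a b c} → a ≡ b [mod n ] → b ≡ c [mod n ] → a ≡ c [mod n ]
≡-mod-trans {n} {a} {b} {c} a≡b b≡c = Signed.∣⇒∣ᵤ (subst (+ n Signed.∣_) (telescope (+ a) (+ b) (+ c))
  (Signed.∣m∣n⇒∣m+n (Signed.∣ᵤ⇒∣ {i = + a -ℤ + b} a≡b) (Signed.∣ᵤ⇒∣ {i = + b -ℤ + c} b≡c)))
  where
  telescope : ∀ x y z → (x -ℤ y) +ℤ (y -ℤ z) ≡ x -ℤ z
  telescope = ℤ-Solver.solve-∀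

≡-mod-setoid : ℕ → Setoid 0ℓ 0ℓ
≡-mod-setoid n = record
  { Carrier       = ℕ
  ; _≈_           = λ a b → a ≡ b [mod n ]
  ; isEquivalence = record
      { refl  = λ {a} → ≡-mod-refl {n} {a}
      ; sym   = λ {a} {b} → ≡-mod-sym {n} {a} {b}
      ; trans = λ {a} {b} {c} → ≡-mod-trans {n} {a} {b} {c}
      }
  }

∣ac-bc∣≡∣a-b∣*c : ∀ a b c → ∣ + (a * c) -ℤ + (b * c) ∣ ≡ ∣ + a -ℤ + b ∣ * c
∣ac-bc∣≡∣a-b∣*c a b c = begin
  ∣ + (a * c) -ℤ + (b * c) ∣   ≡⟨ cong ∣_∣ (cong₂ _-ℤ_ (pos-* a c) (pos-* b c)) ⟩
  ∣ + a *ℤ + c -ℤ + b *ℤ + c ∣ ≡⟨ cong ∣_∣ (factor (+ a) (+ b) (+ c)) ⟩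
  ∣ (+ a -ℤ + b) *ℤ + c ∣      ≡⟨ abs-* (+ a -ℤ + b) (+ c) ⟩
  ∣ + a -ℤ + b ∣ * c           ∎
  where
  open ≡-Reasoning
  factor : ∀ x y z → x *ℤ z -ℤ y *ℤ z ≡ (x -ℤ y) *ℤ z
  factor = ℤ-Solver.solve-∀

≡-mod-*ʳ : ∀ {n} a b c → a ≡ b [mod n ] → (a * c) ≡ (b * c) [mod n ]
≡-mod-*ʳ {n} a b c a≡b = subst (n ∣_) (sym (∣ac-bc∣≡∣a-b∣*c a b c)) (∣m⇒∣m*n c a≡b)

≡-mod-*ˡ : ∀ {n} a b c → a ≡ b [mod n ] → (c * a) ≡ (c * b) [mod n ]
≡-mod-*ˡ {n} a b c a≡b =
  subst₂ (λ x y → x ≡ y [mod n ]) (*-comm a c) (*-comm b c) (≡-mod-*ʳ a b c a≡b)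

*-+-≡-mod : ∀ {n} x y → (x * (y + n)) ≡ (x * y) [mod n ]
*-+-≡-mod {n} x y = subst (λ d → n ∣ ∣ d ∣) (sym difference) (n∣m*n x)
  where
  open ≡-Reasoning
  difference : + (x * (y + n)) -ℤ + (x * y) ≡ + (x * n)
  difference = begin
    + (x * (y + n)) -ℤ + (x * y)         ≡⟨ cong₂ _-ℤ_ (trans (pos-* x (y + n)) (cong (+ x *ℤ_) (pos-+ y n)))
                                                       (pos-* x y) ⟩
    + x *ℤ (+ y +ℤ + n) -ℤ + x *ℤ + y    ≡⟨ cancel (+ x) (+ y) (+ n) ⟩
    + x *ℤ + n                           ≡⟨ pos-* x n ⟨
    + (x * n)                            ∎
    where
    cancel : ∀ x y z → x *ℤ (y +ℤ z) -ℤ x *ℤ y ≡ x *ℤ z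
    cancel = ℤ-Solver.solve-∀

≡-mod-telescope : ∀ {n b} (f : ℕ → ℕ) → (∀ i → b ≤ i → f (suc i) ≡ f i [mod n ]) →
                  ∀ d → f (d + b) ≡ f b [mod n ]
≡-mod-telescope {n} {b} f step zero    = ≡-mod-refl {n} {f b}
≡-mod-telescope {n} {b} f step (suc d) =
  ≡-mod-trans {n} {f (suc (d + b))} {f (d + b)} {f b}
    (step (d + b) (m≤n+m b d)) (≡-mod-telescope f step d)

^-monoʳ-∣ : ∀ m {k l} → k ≤ l → m ^ k ∣ m ^ l
^-monoʳ-∣ m {l = l} z≤n       = 1∣ (m ^ l)
^-monoʳ-∣ m         (s≤s k≤l) = *-monoʳ-∣ m (^-monoʳ-∣ m k≤l)

Odd : ℕ → Set
Odd n = ∃[ t ] n ≡ suc (2 * t)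

odd-* : ∀ {m n} → Odd m → Odd n → Odd (m * n)
odd-* (s , refl) (t , refl) = s + t + 2 * s * t , expand s t
  where
  expand : ∀ s t → suc (2 * s) * suc (2 * t) ≡ suc (2 * (s + t + 2 * s * t))
  expand = solve-∀

2∣z*odd⇒2∣z : ∀ {w} z → Odd w → 2 ∣ z * w → 2 ∣ z
2∣z*odd⇒2∣z z (t , refl) 2∣zw = ∣m+n∣m⇒∣n (subst (2 ∣_) (expand z t) 2∣zw) (m∣m*n (t * z))
  where
  expand : ∀ z t → z * suc (2 * t) ≡ 2 * (t * z) + z
  expand = solve-∀

odd-cancelʳ-∣ : ∀ k {w} z → Odd w → 2 ^ k ∣ z * w → 2 ^ k ∣ z
odd-cancelʳ-∣ zero    z _     _          = 1∣ z
odd-cancelʳ-∣ (suc k) {w} z w-odd 2^[1+k]∣zw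
  with divides q refl ← 2∣z*odd⇒2∣z z w-odd (∣-trans (m∣m*n (2 ^ k)) 2^[1+k]∣zw) =
  subst (2 ^ suc k ∣_) (*-comm 2 q) (*-monoʳ-∣ 2 (odd-cancelʳ-∣ k q w-odd 2^k∣qw))
  where
  regroup : ∀ q w → q * 2 * w ≡ 2 * (q * w)
  regroup = solve-∀
  2^k∣qw : 2 ^ k ∣ q * w
  2^k∣qw = *-cancelˡ-∣ 2 (subst (2 ^ suc k ∣_) (regroup q w) 2^[1+k]∣zw)

≡-mod-cancel-odd : ∀ k {w} x y → Odd w → (x * w) ≡ (y * w) [mod 2 ^ k ] → x ≡ y [mod 2 ^ k ]
≡-mod-cancel-odd k {w} x y w-odd xw≡yw =
  odd-cancelʳ-∣ k ∣ + x -ℤ + y ∣ w-odd (subst (2 ^ k ∣_) (∣ac-bc∣≡∣a-b∣*c x y w) xw≡yw)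

oddProductFrom : ℕ → ℕ → ℕ
oddProductFrom a zero    = 1
oddProductFrom a (suc t) = oddProductFrom a t * (a + suc (2 * t))

oddProduct : ℕ → ℕ
oddProduct = oddProductFrom 0

oddProduct-odd : ∀ n → Odd (oddProduct n)
oddProduct-odd zero    = 0 , refl
oddProduct-odd (suc n) = odd-* (oddProduct-odd n) (n , refl)

oddProductFrom-+ : ∀ a j t → oddProductFrom a (j + t) ≡ oddProductFrom a j * oddProductFrom (a + 2 * j) t
oddProductFrom-+ a j zero    = trans (cong (oddProductFrom a) (+-identityʳ j)) (sym (*-identityʳ _))
oddProductFrom-+ a j (suc t) = begin
  oddProductFrom a (j + suc t)                          ≡⟨ cong (oddProductFrom a) (+-suc j t) ⟩
  oddProductFrom a (j + t) * (a + suc (2 * (j + t)))    ≡⟨ cong (_* (a + suc (2 * (j + t))))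
                                                                 (oddProductFrom-+ a j t) ⟩
  P * Q * (a + suc (2 * (j + t)))                       ≡⟨ regroup P Q a j t ⟩
  P * (Q * (a + 2 * j + suc (2 * t)))                   ∎
  where
  open ≡-Reasoning
  P = oddProductFrom a j
  Q = oddProductFrom (a + 2 * j) t
  regroup : ∀ P Q a j t → P * Q * (a + suc (2 * (j + t))) ≡ P * (Q * (a + 2 * j + suc (2 * t)))
  regroup = solve-∀

oddProductFrom≡oddProduct : ∀ a t → oddProductFrom a t ≡ oddProduct t [mod a ]
oddProductFrom≡oddProduct a zero    = ≡-mod-refl {a} {1}
oddProductFrom≡oddProduct a (suc t) = begin
  E * (a + v) ≡⟨ cong (E *_) (+-comm a v) ⟩
  E * (v + a) ≈⟨ *-+-≡-mod E v ⟩
  E * v       ≈⟨ ≡-mod-*ʳ E (oddProduct t) v (oddProductFrom≡oddProduct a t) ⟩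
  oddProduct t * v ∎
  where
  open import Relation.Binary.Reasoning.Setoid (≡-mod-setoid a)
  E = oddProductFrom a t
  v = suc (2 * t)

oddProduct[2n]≡oddProduct[n]² : ∀ n → oddProduct (2 * n) ≡ (oddProduct n * oddProduct n) [mod 2 * n ]
oddProduct[2n]≡oddProduct[n]² n = begin
  oddProduct (2 * n)                         ≡⟨ cong (λ m → oddProduct (n + m)) (+-identityʳ n) ⟩
  oddProduct (n + n)                         ≡⟨ oddProductFrom-+ 0 n n ⟩
  oddProduct n * oddProductFrom (2 * n) n    ≈⟨ ≡-mod-*ˡ _ _ (oddProduct n) (oddProductFrom≡oddProduct (2 * n) n) ⟩
  oddProduct n * oddProduct n                ∎
  where open import Relation.Binary.Reasoning.Setoid (≡-mod-setoid (2 * n))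

[2n]!≡2^n*n!*oddProduct[n] : ∀ n → (2 * n) ! ≡ 2 ^ n * n ! * oddProduct n
[2n]!≡2^n*n!*oddProduct[n] zero    = refl
[2n]!≡2^n*n!*oddProduct[n] (suc n) = begin
  (2 * suc n) !                                             ≡⟨ cong _! (*-suc 2 n) ⟩
  suc (suc (2 * n)) * (suc (2 * n) * (2 * n) !)             ≡⟨ cong (λ x → suc (suc (2 * n)) * (suc (2 * n) * x))
                                                                    ([2n]!≡2^n*n!*oddProduct[n] n) ⟩
  suc (suc (2 * n)) * (suc (2 * n) * (2 ^ n * n ! * oddProduct n)) ≡⟨ regroup n (2 ^ n) (n !) (oddProduct n) ⟩
  2 * 2 ^ n * (suc n * n !) * (oddProduct n * suc (2 * n))  ∎
  where
  open ≡-Reasoning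
  regroup : ∀ n p f d →
    suc (suc (2 * n)) * (suc (2 * n) * (p * f * d)) ≡ 2 * p * (suc n * f) * (d * suc (2 * n))
  regroup = solve-∀

-- (n + 1)! n! times the binomial coefficients (2n choose n) and (2n choose n − 1) gives (n + 1) (2n)!
-- and n (2n)! respectively; their difference is (2n)!.
[1+n]!*n!∣[2n]! : ∀ n → suc n ! * n ! ∣ (2 * n) !
[1+n]!*n!∣[2n]! zero      = ∣-refl
[1+n]!*n!∣[2n]! n@(suc p) = ∣m+n∣m⇒∣n (divides q₁ n*F+F≡q₁*d) (divides q₂ n*F≡q₂*d)
  where
  open ≡-Reasoning
  F = (2 * n) !
  n≤2n : n ≤ 2 * n
  n≤2n = m≤m+n n (n + 0)
  p≤2n : p ≤ 2 * n
  p≤2n = ≤-trans (n≤1+n p) n≤2n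
  q₁ = _∣_.quotient (k![n∸k]!∣n! n≤2n)
  q₂ = _∣_.quotient (k![n∸k]!∣n! p≤2n)
  F≡q₁*n!*n! : F ≡ q₁ * (n ! * n !)
  F≡q₁*n!*n! = trans (_∣_.equality (k![n∸k]!∣n! n≤2n))
    (cong (λ m → q₁ * (n ! * m !)) (trans (m+n∸m≡n n (n + 0)) (+-identityʳ n)))
  F≡q₂*p!*[1+n]! : F ≡ q₂ * (p ! * suc n !)
  F≡q₂*p!*[1+n]! = trans (_∣_.equality (k![n∸k]!∣n! p≤2n))
    (cong (λ m → q₂ * (p ! * m !)) (trans (cong (_∸ p) (2[1+p]≡p+[2+p] p)) (m+n∸m≡n p (suc n))))
    where
    2[1+p]≡p+[2+p] : ∀ p → 2 * suc p ≡ p + suc (suc p)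
    2[1+p]≡p+[2+p] = solve-∀
  n*F+F≡q₁*d : n * F + F ≡ q₁ * (suc n ! * n !)
  n*F+F≡q₁*d = begin
    n * F + F                                 ≡⟨ cong (λ x → n * x + x) F≡q₁*n!*n! ⟩
    n * (q₁ * (n ! * n !)) + q₁ * (n ! * n !) ≡⟨ regroup n q₁ (n !) ⟩
    q₁ * (suc n * n ! * n !)                  ∎
    where
    regroup : ∀ n q f → n * (q * (f * f)) + q * (f * f) ≡ q * (suc n * f * f)
    regroup = solve-∀
  n*F≡q₂*d : n * F ≡ q₂ * (suc n ! * n !)
  n*F≡q₂*d = begin
    n * F                          ≡⟨ cong (n *_) F≡q₂*p!*[1+n]! ⟩
    n * (q₂ * (p ! * suc n !))     ≡⟨ regroup n q₂ (p !) (suc n !) ⟩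
    q₂ * (suc n ! * (n * p !))     ∎
    where
    regroup : ∀ n q f g → n * (q * (f * g)) ≡ q * (g * (n * f))
    regroup = solve-∀

catalan*[1+n]!*n!≡[2n]! : ∀ n → catalan n * (suc n ! * n !) ≡ (2 * n) !
catalan*[1+n]!*n!≡[2n]! n = begin
  catalan n * (suc n ! * n !)   ≡⟨ cong (λ m → catalan n * (m ! * n !)) (+-comm 1 n) ⟩
  catalan n * ((n + 1) ! * n !) ≡⟨ m/n*n≡m {{(n + 1) !* n !≢0}}
                                    (subst (λ m → m ! * n ! ∣ (2 * n) !) (+-comm 1 n) ([1+n]!*n!∣[2n]! n)) ⟩
  (2 * n) !                     ∎
  where open ≡-Reasoning

catalan*[1+n]!≡2^n*oddProduct[n] : ∀ n → catalan n * suc n ! ≡ 2 ^ n * oddProduct n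
catalan*[1+n]!≡2^n*oddProduct[n] n = *-cancelʳ-≡ _ _ (n !) {{n !≢0}} (begin
  catalan n * suc n ! * n !     ≡⟨ *-assoc (catalan n) (suc n !) (n !) ⟩
  catalan n * (suc n ! * n !)   ≡⟨ catalan*[1+n]!*n!≡[2n]! n ⟩
  (2 * n) !                     ≡⟨ [2n]!≡2^n*n!*oddProduct[n] n ⟩
  2 ^ n * n ! * oddProduct n    ≡⟨ regroup (2 ^ n) (n !) (oddProduct n) ⟩
  2 ^ n * oddProduct n * n !    ∎)
  where
  open ≡-Reasoning
  regroup : ∀ p f d → p * f * d ≡ p * d * f
  regroup = solve-∀

catalan[1+2n]*[1+n]!*oddProduct[1+n]≡2^n*oddProduct[1+2n] : ∀ n →
  catalan (suc (2 * n)) * suc n ! * oddProduct (suc n) ≡ 2 ^ n * oddProduct (suc (2 * n))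
catalan[1+2n]*[1+n]!*oddProduct[1+n]≡2^n*oddProduct[1+2n] n =
  *-cancelˡ-≡ _ _ (2 ^ suc n) {{m^n≢0 2 (suc n)}} (begin
  2 ^ suc n * (C * suc n ! * D)            ≡⟨ regroup (2 ^ suc n) C (suc n !) D ⟩
  C * (2 ^ suc n * suc n ! * D)            ≡⟨ cong (C *_) ([2n]!≡2^n*n!*oddProduct[n] (suc n)) ⟨
  C * (2 * suc n) !                        ≡⟨ cong (λ m → C * m !) (*-suc 2 n) ⟩
  C * suc u !                              ≡⟨ catalan*[1+n]!≡2^n*oddProduct[n] u ⟩
  2 ^ u * oddProduct u                     ≡⟨ cong (λ m → 2 ^ suc (n + m) * oddProduct u) (+-identityʳ n) ⟩
  2 ^ (suc n + n) * oddProduct u           ≡⟨ cong (_* oddProduct u) (^-distribˡ-+-* 2 (suc n) n) ⟩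
  2 ^ suc n * 2 ^ n * oddProduct u         ≡⟨ *-assoc (2 ^ suc n) (2 ^ n) (oddProduct u) ⟩
  2 ^ suc n * (2 ^ n * oddProduct u)       ∎)
  where
  open ≡-Reasoning
  u = suc (2 * n)
  C = catalan u
  D = oddProduct (suc n)
  regroup : ∀ p c f d → p * (c * f * d) ≡ c * (p * f * d)
  regroup = solve-∀

catalan-doubling : ∀ n →
  catalan (suc (2 * n)) * oddProduct (suc n) * oddProduct n ≡ catalan n * oddProduct (suc (2 * n))
catalan-doubling n = *-cancelˡ-≡ _ _ (suc n !) {{suc n !≢0}} (begin
  suc n ! * (C′ * D * oddProduct n)        ≡⟨ regroup (suc n !) C′ D (oddProduct n) ⟩
  C′ * suc n ! * D * oddProduct n          ≡⟨ cong (_* oddProduct n)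
                                                (catalan[1+2n]*[1+n]!*oddProduct[1+n]≡2^n*oddProduct[1+2n] n) ⟩
  2 ^ n * oddProduct u * oddProduct n      ≡⟨ swap (2 ^ n) (oddProduct u) (oddProduct n) ⟩
  2 ^ n * oddProduct n * oddProduct u      ≡⟨ cong (_* oddProduct u) (catalan*[1+n]!≡2^n*oddProduct[n] n) ⟨
  catalan n * suc n ! * oddProduct u       ≡⟨ swap (catalan n) (suc n !) (oddProduct u) ⟩
  catalan n * oddProduct u * suc n !       ≡⟨ *-comm (catalan n * oddProduct u) (suc n !) ⟩
  suc n ! * (catalan n * oddProduct u)     ∎)
  where
  open ≡-Reasoning
  u = suc (2 * n)
  C′ = catalan u
  D = oddProduct (suc n)
  regroup : ∀ f c d e → f * (c * d * e) ≡ c * f * d * e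
  regroup = solve-∀
  swap : ∀ a b c → a * b * c ≡ a * c * b
  swap = solve-∀

-- Multiply catalan-doubling by 4n + 3 = (2n + 1) + 2(n + 1): modulo 2(n + 1) this factor acts as 2n + 1
-- on the left, while on the right it completes (4n + 1)!! to (4n + 3)!! ≡ ((2n + 1)!!)².
catalan-doubling-≡-mod : ∀ n →
  (catalan (suc (2 * n)) * (oddProduct (suc n) * oddProduct (suc n)))
    ≡ (catalan n * (oddProduct (suc n) * oddProduct (suc n))) [mod 2 * suc n ]
catalan-doubling-≡-mod n = begin
  C′ * (D * D)                               ≡⟨ regroup C′ D (oddProduct n) u ⟩
  C′ * D * oddProduct n * u                  ≈⟨ *-+-≡-mod (C′ * D * oddProduct n) u ⟨
  C′ * D * oddProduct n * (u + 2 * suc n)    ≡⟨ cong (_* (u + 2 * suc n)) (catalan-doubling n) ⟩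
  C * oddProduct u * (u + 2 * suc n)         ≡⟨ *-assoc C (oddProduct u) (u + 2 * suc n) ⟩
  C * (oddProduct u * (u + 2 * suc n))       ≡⟨ cong (λ m → C * (oddProduct u * m)) (u+2[1+n]≡1+2u n) ⟩
  C * oddProduct (suc u)                     ≡⟨ cong (λ m → C * oddProduct m) (*-suc 2 n) ⟨
  C * oddProduct (2 * suc n)                 ≈⟨ ≡-mod-*ˡ _ _ C (oddProduct[2n]≡oddProduct[n]² (suc n)) ⟩
  C * (D * D)                                ∎
  where
  open import Relation.Binary.Reasoning.Setoid (≡-mod-setoid (2 * suc n))
  u = suc (2 * n)
  C′ = catalan u
  C = catalan n
  D = oddProduct (suc n)
  regroup : ∀ c d e u → c * (d * (e * u)) ≡ c * d * e * u
  regroup = solve-∀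
  u+2[1+n]≡1+2u : ∀ n → suc (2 * n) + 2 * suc n ≡ suc (2 * suc (2 * n))
  u+2[1+n]≡1+2u = solve-∀

catalan[1+2n]≡catalan[n] : ∀ {n m} → suc n ≡ 2 ^ m → catalan (suc (2 * n)) ≡ catalan n [mod 2 ^ suc m ]
catalan[1+2n]≡catalan[n] {n} {m} 1+n≡2^m =
  ≡-mod-cancel-odd (suc m) (catalan (suc (2 * n))) (catalan n) (odd-* D-odd D-odd)
    (subst (λ a → (catalan (suc (2 * n)) * (D * D)) ≡ (catalan n * (D * D)) [mod a ])
      (cong (2 *_) 1+n≡2^m) (catalan-doubling-≡-mod n))
  where
  D = oddProduct (suc n)
  D-odd : Odd D
  D-odd = oddProduct-odd (suc n)

catalan[2^[1+m]-1]≡catalan[2^m-1] : ∀ m → catalan (2 ^ suc m ∸ 1) ≡ catalan (2 ^ m ∸ 1) [mod 2 ^ suc m ]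
catalan[2^[1+m]-1]≡catalan[2^m-1] m =
  subst (λ i → catalan i ≡ catalan n [mod 2 ^ suc m ]) 1+2n≡2^[1+m]-1
    (catalan[1+2n]≡catalan[n] {m = m} 1+n≡2^m)
  where
  n = 2 ^ m ∸ 1
  1+n≡2^m : suc n ≡ 2 ^ m
  1+n≡2^m = suc-pred (2 ^ m) {{m^n≢0 2 m}}
  1+2n≡2^[1+m]-1 : suc (2 * n) ≡ 2 ^ suc m ∸ 1
  1+2n≡2^[1+m]-1 = cong pred (trans (sym (*-suc 2 n)) (cong (2 *_) 1+n≡2^m))

proposition4p1 : (k : ℕ) → 2 ≤ k → (m : ℕ) → k ∸ 1 ≤ m →
    catalan (2 ^ m ∸ 1) ≡ catalan (2 ^ (k ∸ 1) ∸ 1) [mod 2 ^ k ]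
proposition4p1 k _ m k∸1≤m =
  subst (λ i → catalan (2 ^ i ∸ 1) ≡ catalan (2 ^ (k ∸ 1) ∸ 1) [mod 2 ^ k ]) (m∸n+n≡m k∸1≤m)
    (≡-mod-telescope (λ i → catalan (2 ^ i ∸ 1)) step (m ∸ (k ∸ 1)))
  where
  step : ∀ i → k ∸ 1 ≤ i → catalan (2 ^ suc i ∸ 1) ≡ catalan (2 ^ i ∸ 1) [mod 2 ^ k ]
  step i k∸1≤i =
    ∣-trans (^-monoʳ-∣ 2 (≤-trans (m≤n+m∸n k 1) (s≤s k∸1≤i))) (catalan[2^[1+m]-1]≡catalan[2^m-1] i)
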